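{- Let $G$ be a connected graph on $n$ vertices, with neighbor-locating chromatic number $k$ and average degree $d$. Then $n = \mathcal{O}(d^2 k^{\lceil d\rceil+1})$. More precisely: (i) if $k \le \lceil d\rceil$, then $n < \lceil d\rceil k^{\lceil d\rceil-1}$; (ii) if $k \ge \lceil d\rceil+1$, then $n \le k\sum_{i=1}^{\lceil d\rceil}(\lceil d\rceil+1-i)\binom{k-1}{i}$. Moreover, any connected graph $G$ with neighbor-locating chromatic number $k \ge \lceil d\rceil+1$ and average degree $d$ whose order attains the upper bound in (ii) has maximum degree $\Delta \le \lceil d\rceil+1$ and exactly $k\binom{k-1}{i}$ vertices of degree $i$ (for $1\le i\le \lceil d\rceil$).
   Context: All graphs are simple. A proper $k$-coloring $f$ of $G$ is neighbor-locating if any two distinct vertices $x,y$ with $f(x)=f(y)$ have different sets of colors appearing in their neighborhoods. The neighbor-locating chromatic number $\chi_{NL}(G)$ is the minimum $k$ admitting such a coloring. The average degree of a graph with $n$ vertices and $m$ edges is $2m/n$. -}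

module Defs where

open import Data.Nat using (ℕ; zero; suc; _+_; _*_; _∸_; _≟_)
open import Data.Nat.DivMod using (_/_)
open import Data.Nat.Combinatorics using (_C_)
open import Data.Bool using (Bool; true; false; if_then_else_)
open import Data.Fin using (Fin)
open import Data.List using (List; map; length; filter; allFin)
open import Data.Nat.ListAction using (sum)
open import Data.Product using (Σ; ∃; _×_)
open import Relation.Binary.PropositionalEquality using (_≡_; _≢_)
open import Relation.Nullary using (¬_)
open import Function.Bundles using (_⇔_)

record Graph (n : ℕ) : Set where
  field
    adj   : Fin n → Fin n → Bool
    sym   : ∀ u v → adj u v ≡ adj v u
    irrefl : ∀ v → adj v v ≡ false
open Graph public

module _ {n : ℕ} (G : Graph n) where

  Adj : Fin n → Fin n → Set
  Adj u v = adj G u v ≡ true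

  data Reach (u : Fin n) : Fin n → Set where
    here : Reach u u
    step : ∀ {v w} → Reach u v → Adj v w → Reach u w

  Connected : Set
  Connected = ∀ u v → Reach u v

  degree : Fin n → ℕ
  degree v = sum (map (λ w → if adj G v w then 1 else 0) (allFin n))

  degreeSum : ℕ
  degreeSum = sum (map degree (allFin n))

  numDeg : ℕ → ℕ
  numDeg i = length (filter (λ v → degree v ≟ i) (allFin n))

  MaxDegreeAtMost : ℕ → Set
  MaxDegreeAtMost b = ∀ v → Data.Nat._≤_ (degree v) b

  Proper : {k : ℕ} → (Fin n → Fin k) → Set
  Proper f = ∀ u v → Adj u v → f u ≢ f v

  NColor : {k : ℕ} → (Fin n → Fin k) → Fin n → Fin k → Set
  NColor f x c = ∃ λ w → Adj x w × f w ≡ c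

  NeighborLocating : {k : ℕ} → (Fin n → Fin k) → Set
  NeighborLocating f = Proper f ×
    (∀ x y → x ≢ y → f x ≡ f y → ¬ (∀ c → NColor f x c ⇔ NColor f y c))

  HasNLColoring : ℕ → Set
  HasNLColoring k = Σ (Fin n → Fin k) NeighborLocating

  χNL≡ : ℕ → Set
  χNL≡ k = HasNLColoring k × (∀ j → Data.Nat._<_ j k → ¬ HasNLColoring j)

-- ceiling division ⌈a / b⌉ (b > 0); ceilDiv a 0 = 0 by convention (unused)
ceilDiv : ℕ → ℕ → ℕ
ceilDiv a zero = 0
ceilDiv a (suc m) = (a + m) / suc m

-- ⌈d⌉ where d = 2m/n is the average degree
ceilAvgDeg : {n : ℕ} → Graph n → ℕ
ceilAvgDeg {n} G = ceilDiv (degreeSum G) n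

sum1 : ℕ → (ℕ → ℕ) → ℕ
sum1 zero f = 0
sum1 (suc m) f = sum1 m f + f (suc m)

boundII : ℕ → ℕ → ℕ
boundII D k = k * sum1 D (λ i → (suc D ∸ i) * ((k ∸ 1) C i))

{-# OPTIONS --safe #-}
module Submission where

-- Fix a neighbor-locating colouring f with k colours and call the palette of a vertex v the set of
-- colours other than f v met in its neighbourhood. The neighbor-locating condition says exactly
-- that v ↦ (f v , palette v) is injective. In a connected graph with at least two vertices no
-- palette is empty, so n < k 2^(k-1) ≤ ⌈d⌉ k^(⌈d⌉-1) when k ≤ ⌈d⌉, which is (i).
-- For (ii), at most k C(k-1, i) vertices have a palette of size i, and a palette is no larger
-- than the degree. Summing ⌈d⌉ + 1 ≤ deg v + (⌈d⌉ + 1 - |palette v|) over all v and using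
-- Σ deg v ≤ ⌈d⌉ n gives n ≤ Σ_v (⌈d⌉ + 1 - |palette v|) = Σ_i (⌈d⌉ + 1 - i) #{v : |palette v| = i}.
-- If (ii) is an equality, all these inequalities are tight: deg v = |palette v| ≤ ⌈d⌉ + 1 for
-- every v, and #{v : |palette v| = i} = k C(k-1, i) for 1 ≤ i ≤ ⌈d⌉.

open import Defs hiding (sym)
open import Algebra.Properties.CommutativeSemigroup using (interchange; x∙yz≈y∙xz)
open import Data.Bool using (Bool; true; false; if_then_else_)
import Data.Bool as Bool
open import Data.Empty using (⊥; ⊥-elim)
open import Data.Fin using (Fin; zero; suc; punchIn; punchOut)
import Data.Fin as Fin
open import Data.Fin.Properties
  using (any?; injective⇒≤; punchIn-injective; punchIn-punchOut; punchInᵢ≢i)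
open import Data.List
  using (List; []; _∷_; [_]; _++_; map; length; filter; lookup; allFin; cartesianProduct)
open import Data.List.Properties using (length-map; length-++; length-tabulate; filter-≐)
open import Data.List.Membership.Propositional using (_∈_; _∉_)
open import Data.List.Membership.Propositional.Properties
  using ( ∈-lookup; ∈-map⁺; ∈-map⁻; ∈-++⁺ˡ; ∈-++⁺ʳ; ∈-allFin; ∈-filter⁺; ∈-filter⁻
        ; ∈-cartesianProduct⁺)
open import Data.List.Relation.Binary.Subset.Propositional using (_⊆_)
open import Data.List.Relation.Binary.Sublist.Propositional
  using ([]; _∷_; _∷ʳ_; minimum) renaming (_⊆_ to _⊑_)
open import Data.List.Relation.Binary.Sublist.Propositional.Properties using (filter-⊆)
import Data.List.Relation.Unary.All as All
open import Data.List.Relation.Unary.All.Properties using (¬Any⇒All¬)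
open import Data.List.Relation.Unary.Any using (here; there; index)
open import Data.List.Relation.Unary.Any.Properties using (lookup-index)
open import Data.List.Relation.Unary.AllPairs using (_∷_)
open import Data.List.Relation.Unary.Unique.Propositional using (Unique)
open import Data.List.Relation.Unary.Unique.Propositional.Properties
  using (allFin⁺; map⁺; filter⁺)
open import Data.Nat
  using (ℕ; zero; suc; _+_; _*_; _∸_; _^_; _≤_; _<_; z≤n; s≤s; >-nonZero)
open import Data.Nat.Combinatorics using (_C_; nCk+nC[k+1]≡[n+1]C[k+1])
open import Data.Nat.DivMod using (_/_; _%_; m≡m%n+[m/n]*n; m%n<n)
open import Data.Nat.ListAction using (sum)
open import Data.Nat.Properties
open import Data.Product using (∃; _×_; _,_; proj₁; proj₂)
open import Data.Product.Properties using (,-injective)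
open import Data.Sum using (inj₁; inj₂)
open import Function using (_∘_)
open import Function.Bundles using (mk⇔)
open import Function.Definitions using (Injective)
open import Relation.Nullary using (Dec; does; yes; no)
open import Relation.Nullary.Decidable using (dec-true; dec-false; _×-dec_)
open import Relation.Binary.PropositionalEquality
  using (_≡_; _≢_; refl; sym; trans; cong; cong₂; subst; subst₂; module ≡-Reasoning)

+-interchange : ∀ a b c d → (a + b) + (c + d) ≡ (a + c) + (b + d)
+-interchange = interchange +-commutativeSemigroup

m*[n*o]≡n*[m*o] : ∀ m n o → m * (n * o) ≡ n * (m * o)
m*[n*o]≡n*[m*o] = x∙yz≈y∙xz *-commutativeSemigroup

≤ceilDiv* : ∀ a m → a ≤ ceilDiv a (suc m) * suc m
≤ceilDiv* a m = +-cancelʳ-≤ m a (q * suc m) (begin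
  a + m                       ≡⟨ m≡m%n+[m/n]*n (a + m) (suc m) ⟩
  (a + m) % suc m + q * suc m ≤⟨ +-monoˡ-≤ (q * suc m) (≤-pred (m%n<n (a + m) (suc m))) ⟩
  m + q * suc m               ≡⟨ +-comm m (q * suc m) ⟩
  q * suc m + m               ∎)
  where
  open ≤-Reasoning
  q = (a + m) / suc m

2^k≤[1+k]^k : ∀ k → 2 ^ k ≤ suc k ^ k
2^k≤[1+k]^k zero    = ≤-refl
2^k≤[1+k]^k (suc k) = ^-monoˡ-≤ (suc k) (s≤s (s≤s z≤n))

[1+k]*2^k≤D*[1+k]^[D∸1] : ∀ {k D} → suc k ≤ D → suc k * 2 ^ k ≤ D * suc k ^ (D ∸ 1)
[1+k]*2^k≤D*[1+k]^[D∸1] {k} 1+k≤D =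
  *-mono-≤ 1+k≤D (≤-trans (2^k≤[1+k]^k k) (^-monoʳ-≤ (suc k) (∸-monoˡ-≤ 1 1+k≤D)))

+-tight : ∀ {a b c d} → a ≤ c → b ≤ d → c + d ≤ a + b → a ≡ c × b ≡ d
+-tight {a} {b} {c} {d} a≤c b≤d c+d≤a+b =
    ≤-antisym a≤c (+-cancelʳ-≤ d c a (≤-trans c+d≤a+b (+-monoʳ-≤ a b≤d)))
  , ≤-antisym b≤d (+-cancelˡ-≤ c d b (≤-trans c+d≤a+b (+-monoˡ-≤ b a≤c)))

module _ {A : Set} where

  lookup-injective : {xs : List A} → Unique xs → Injective _≡_ _≡_ (lookup xs)
  lookup-injective (_ ∷ _) {zero} {zero} _ = refl
  lookup-injective (x∉xs ∷ _) {zero} {suc j} eq = ⊥-elim (All.lookup x∉xs (∈-lookup j) eq)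
  lookup-injective (x∉xs ∷ _) {suc i} {zero} eq = ⊥-elim (All.lookup x∉xs (∈-lookup i) (sym eq))
  lookup-injective (_ ∷ u) {suc i} {suc j} eq = cong suc (lookup-injective u eq)

  unique-⊆⇒length≤ : {xs ys : List A} → Unique xs → xs ⊆ ys → length xs ≤ length ys
  unique-⊆⇒length≤ {xs} {ys} u xs⊆ys = injective⇒≤ position-injective
    where
    position : Fin (length xs) → Fin (length ys)
    position i = index (xs⊆ys (∈-lookup i))

    position-injective : Injective _≡_ _≡_ position
    position-injective {i} {j} eq = lookup-injective u (begin
      lookup xs i         ≡⟨ lookup-index (xs⊆ys (∈-lookup i)) ⟩
      lookup ys (position i) ≡⟨ cong (lookup ys) eq ⟩
      lookup ys (position j) ≡⟨ lookup-index (xs⊆ys (∈-lookup j)) ⟨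
      lookup xs j         ∎)
      where open ≡-Reasoning

  unique-⊆-∉⇒length< : {xs ys : List A} {y : A} → Unique xs → xs ⊆ ys → y ∈ ys → y ∉ xs →
                        length xs < length ys
  unique-⊆-∉⇒length< u xs⊆ys y∈ys y∉xs =
    unique-⊆⇒length≤ (¬Any⇒All¬ _ y∉xs ∷ u) λ { (here refl) → y∈ys ; (there p) → xs⊆ys p }

  combinations : ℕ → List A → List (List A)
  combinations zero    xs       = [ [] ]
  combinations (suc i) []       = []
  combinations (suc i) (x ∷ xs) = map (x ∷_) (combinations i xs) ++ combinations (suc i) xs

  length-combinations : ∀ i xs → length (combinations i xs) ≡ length xs C i
  length-combinations zero    xs       = refl
  length-combinations (suc i) []       = refl
  length-combinations (suc i) (x ∷ xs) = begin
    length (map (x ∷_) (combinations i xs) ++ combinations (suc i) xs)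
      ≡⟨ length-++ (map (x ∷_) (combinations i xs)) ⟩
    length (map (x ∷_) (combinations i xs)) + length (combinations (suc i) xs)
      ≡⟨ cong₂ _+_ (trans (length-map (x ∷_) (combinations i xs)) (length-combinations i xs))
                   (length-combinations (suc i) xs) ⟩
    length xs C i + length xs C suc i
      ≡⟨ nCk+nC[k+1]≡[n+1]C[k+1] (length xs) i ⟩
    suc (length xs) C suc i ∎
    where open ≡-Reasoning

  sublist∈combinations : {xs ys : List A} → ys ⊑ xs → ys ∈ combinations (length ys) xs
  sublist∈combinations {ys = []} _ = here refl
  sublist∈combinations {ys = y ∷ ys} (x ∷ʳ p) = ∈-++⁺ʳ _ (sublist∈combinations p)
  sublist∈combinations {ys = y ∷ ys} (refl ∷ p) =
    ∈-++⁺ˡ (∈-map⁺ (y ∷_) (sublist∈combinations p))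

  sublists : List A → List (List A)
  sublists []       = [ [] ]
  sublists (x ∷ xs) = map (x ∷_) (sublists xs) ++ sublists xs

  length-sublists : ∀ xs → length (sublists xs) ≡ 2 ^ length xs
  length-sublists []       = refl
  length-sublists (x ∷ xs) = begin
    length (map (x ∷_) (sublists xs) ++ sublists xs)
      ≡⟨ length-++ (map (x ∷_) (sublists xs)) ⟩
    length (map (x ∷_) (sublists xs)) + length (sublists xs)
      ≡⟨ cong (_+ length (sublists xs)) (length-map (x ∷_) (sublists xs)) ⟩
    length (sublists xs) + length (sublists xs)
      ≡⟨ cong (λ m → m + m) (length-sublists xs) ⟩
    2 ^ length xs + 2 ^ length xs
      ≡⟨ cong (2 ^ length xs +_) (+-identityʳ (2 ^ length xs)) ⟨
    2 ^ suc (length xs) ∎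
    where open ≡-Reasoning

  sublist∈sublists : {xs ys : List A} → ys ⊑ xs → ys ∈ sublists xs
  sublist∈sublists [] = here refl
  sublist∈sublists (x ∷ʳ p) = ∈-++⁺ʳ _ (sublist∈sublists p)
  sublist∈sublists (refl ∷ p) = ∈-++⁺ˡ (∈-map⁺ (_ ∷_) (sublist∈sublists p))

length-allFin : ∀ n → length (allFin n) ≡ n
length-allFin n = length-tabulate (λ i → i)

module _ {A B : Set} where

  length-cartesianProduct : (xs : List A) (ys : List B) →
                            length (cartesianProduct xs ys) ≡ length xs * length ys
  length-cartesianProduct []       ys = refl
  length-cartesianProduct (x ∷ xs) ys = begin
    length (map (x ,_) ys ++ cartesianProduct xs ys)
      ≡⟨ length-++ (map (x ,_) ys) ⟩
    length (map (x ,_) ys) + length (cartesianProduct xs ys)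
      ≡⟨ cong₂ _+_ (length-map (x ,_) ys) (length-cartesianProduct xs ys) ⟩
    length ys + length xs * length ys ∎
    where open ≡-Reasoning

module _ {A : Set} where

  sum-map-+ : (f g : A → ℕ) (xs : List A) →
              sum (map (λ x → f x + g x) xs) ≡ sum (map f xs) + sum (map g xs)
  sum-map-+ f g []       = refl
  sum-map-+ f g (x ∷ xs) =
    trans (cong (f x + g x +_) (sum-map-+ f g xs)) (+-interchange (f x) (g x) _ _)

  sum-map-const : (c : ℕ) (xs : List A) → sum (map (λ _ → c) xs) ≡ length xs * c
  sum-map-const c []       = refl
  sum-map-const c (x ∷ xs) = cong (c +_) (sum-map-const c xs)

  sum-map-mono : {f g : A → ℕ} → (∀ x → f x ≤ g x) → (xs : List A) →
                 sum (map f xs) ≤ sum (map g xs)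
  sum-map-mono f≤g []       = z≤n
  sum-map-mono f≤g (x ∷ xs) = +-mono-≤ (f≤g x) (sum-map-mono f≤g xs)

  sum-map-tight : {f g : A → ℕ} → (∀ x → f x ≤ g x) → {xs : List A} →
                  sum (map g xs) ≤ sum (map f xs) → ∀ {x} → x ∈ xs → f x ≡ g x
  sum-map-tight f≤g {y ∷ xs} Σg≤Σf x∈ with +-tight (f≤g y) (sum-map-mono f≤g xs) Σg≤Σf | x∈
  ... | fy≡gy , _     | here refl  = fy≡gy
  ... | _     , Σf≡Σg | there x∈xs = sum-map-tight f≤g (≤-reflexive (sym Σf≡Σg)) x∈xs

  sum-map-indicator : (b : A → Bool) (xs : List A) →
    sum (map (λ x → if b x then 1 else 0) xs) ≡ length (filter (λ x → b x Bool.≟ true) xs)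
  sum-map-indicator b []       = refl
  sum-map-indicator b (x ∷ xs) with b x
  ... | true  = cong suc (sum-map-indicator b xs)
  ... | false = sum-map-indicator b xs

sum1-cong : ∀ D {f g : ℕ → ℕ} → (∀ i → f i ≡ g i) → sum1 D f ≡ sum1 D g
sum1-cong zero    f≡g = refl
sum1-cong (suc D) f≡g = cong₂ _+_ (sum1-cong D f≡g) (f≡g (suc D))

sum1-+ : ∀ D (f g : ℕ → ℕ) → sum1 D (λ i → f i + g i) ≡ sum1 D f + sum1 D g
sum1-+ zero    f g = refl
sum1-+ (suc D) f g =
  trans (cong (_+ (f (suc D) + g (suc D))) (sum1-+ D f g))
        (+-interchange (sum1 D f) (sum1 D g) (f (suc D)) (g (suc D)))

sum1-*ˡ : ∀ D c (f : ℕ → ℕ) → sum1 D (λ i → c * f i) ≡ c * sum1 D f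
sum1-*ˡ zero    c f = sym (*-zeroʳ c)
sum1-*ˡ (suc D) c f =
  trans (cong (_+ c * f (suc D)) (sum1-*ˡ D c f))
        (sym (*-distribˡ-+ c (sum1 D f) (f (suc D))))

sum1-mono : ∀ D {f g : ℕ → ℕ} → (∀ i → f i ≤ g i) → sum1 D f ≤ sum1 D g
sum1-mono zero    f≤g = z≤n
sum1-mono (suc D) f≤g = +-mono-≤ (sum1-mono D f≤g) (f≤g (suc D))

sum1-tight : ∀ D {f g : ℕ → ℕ} → (∀ i → f i ≤ g i) → sum1 D g ≤ sum1 D f →
             ∀ {i} → 1 ≤ i → i ≤ D → f i ≡ g i
sum1-tight zero    f≤g Σg≤Σf (s≤s _) ()
sum1-tight (suc D) f≤g Σg≤Σf 1≤i i≤1+D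
  with +-tight (sum1-mono D f≤g) (f≤g (suc D)) Σg≤Σf | m≤n⇒m<n∨m≡n i≤1+D
... | _     , top≡ | inj₂ refl       = top≡
... | rest≡ , _    | inj₁ (s≤s i≤D) = sum1-tight D f≤g (≤-reflexive (sym rest≡)) 1≤i i≤D

δ : ℕ → ℕ → ℕ
δ a i = if does (a ≟ i) then 1 else 0

sum1-δ-out : ∀ D (h : ℕ → ℕ) {a} → D < a → sum1 D (λ i → h i * δ a i) ≡ 0
sum1-δ-out zero    h D<a = refl
sum1-δ-out (suc D) h {a} D<a
  rewrite sum1-δ-out D h (<-trans (n<1+n D) D<a)
        | dec-false (a ≟ suc D) (λ a≡1+D → <-irrefl (sym a≡1+D) D<a) = *-zeroʳ (h (suc D))

sum1-δ : ∀ D (h : ℕ → ℕ) {a} → 1 ≤ a → a ≤ D → sum1 D (λ i → h i * δ a i) ≡ h a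
sum1-δ zero    h (s≤s _) ()
sum1-δ (suc D) h {a} 1≤a a≤1+D with m≤n⇒m<n∨m≡n a≤1+D
... | inj₂ refl
  rewrite sum1-δ-out D h (n<1+n D) | dec-true (suc D ≟ suc D) refl = *-identityʳ (h (suc D))
... | inj₁ (s≤s a≤D)
  rewrite sum1-δ D h 1≤a a≤D
        | dec-false (a ≟ suc D) (λ a≡1+D → <-irrefl a≡1+D (s≤s a≤D))
  = trans (cong (h a +_) (*-zeroʳ (h (suc D)))) (+-identityʳ (h a))

module _ {A : Set} (g : A → ℕ) where

  length-filter-≟-∷ : ∀ i x xs →
    length (filter (λ y → g y ≟ i) (x ∷ xs)) ≡ δ (g x) i + length (filter (λ y → g y ≟ i) xs)
  length-filter-≟-∷ i x xs with does (g x ≟ i)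
  ... | true  = refl
  ... | false = refl

  sum-map-byValue : ∀ D (h : ℕ → ℕ) → (∀ x → 1 ≤ g x) → (∀ i → D < i → h i ≡ 0) →
    (xs : List A) →
    sum (map (h ∘ g) xs) ≡ sum1 D (λ i → h i * length (filter (λ x → g x ≟ i) xs))
  sum-map-byValue D h g≥1 h-vanishes [] =
    sym (trans (sum1-cong D (λ i → *-zeroʳ (h i))) (sum1-*ˡ D 0 (λ _ → 0)))
  sum-map-byValue D h g≥1 h-vanishes (x ∷ xs) = begin
    h (g x) + sum (map (h ∘ g) xs)
      ≡⟨ cong₂ _+_ (sym selected) (sum-map-byValue D h g≥1 h-vanishes xs) ⟩
    sum1 D (λ i → h i * δ (g x) i) + sum1 D (λ i → h i * count i xs)
      ≡⟨ sum1-+ D _ _ ⟨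
    sum1 D (λ i → h i * δ (g x) i + h i * count i xs)
      ≡⟨ sum1-cong D (λ i → trans (sym (*-distribˡ-+ (h i) _ _))
                                  (cong (h i *_) (sym (length-filter-≟-∷ i x xs)))) ⟩
    sum1 D (λ i → h i * count i (x ∷ xs)) ∎
    where
    open ≡-Reasoning
    count : ℕ → List A → ℕ
    count i ys = length (filter (λ y → g y ≟ i) ys)
    selected : sum1 D (λ i → h i * δ (g x) i) ≡ h (g x)
    selected with g x ≤? D
    ... | yes gx≤D = sum1-δ D h (g≥1 x) gx≤D
    ... | no  gx≰D =
      trans (sum1-δ-out D h (≰⇒> gx≰D)) (sym (h-vanishes (g x) (≰⇒> gx≰D)))

boundII≡ : ∀ D k → boundII D k ≡ sum1 D (λ i → (suc D ∸ i) * (k * ((k ∸ 1) C i)))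
boundII≡ D k = trans (sym (sum1-*ˡ D k (λ i → (suc D ∸ i) * ((k ∸ 1) C i))))
                     (sum1-cong D (λ i → m*[n*o]≡n*[m*o] k (suc D ∸ i) ((k ∸ 1) C i)))

-- In the application xs lists the vertices, s is the palette size and a i bounds the number
-- of vertices whose palette has size i.
module SlackCounting {A : Set} (xs : List A) (s deg : A → ℕ) (D : ℕ)
  (s≥1 : ∀ x → 1 ≤ s x) (s≤deg : ∀ x → s x ≤ deg x)
  (Σdeg≤ : sum (map deg xs) ≤ D * length xs)
  (a : ℕ → ℕ) (count≤a : ∀ i → length (filter (λ x → s x ≟ i) xs) ≤ a i) where

  slack : A → ℕ
  slack x = suc D ∸ s x

  count : ℕ → ℕ
  count i = length (filter (λ x → s x ≟ i) xs)

  bound : ℕ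
  bound = sum1 D (λ i → (suc D ∸ i) * a i)

  weighted-count≤a : ∀ i → (suc D ∸ i) * count i ≤ (suc D ∸ i) * a i
  weighted-count≤a i = *-monoʳ-≤ (suc D ∸ i) (count≤a i)

  1+D≤deg+slack : ∀ x → suc D ≤ deg x + slack x
  1+D≤deg+slack x = ≤-trans (m≤n+m∸n (suc D) (s x)) (+-monoˡ-≤ (slack x) (s≤deg x))

  weightedCount : ℕ
  weightedCount = sum1 D (λ i → (suc D ∸ i) * count i)

  Σ[deg+slack]≡ : sum (map (λ x → deg x + slack x) xs) ≡ sum (map deg xs) + weightedCount
  Σ[deg+slack]≡ = trans (sum-map-+ deg slack xs) (cong (sum (map deg xs) +_)
    (sum-map-byValue s D (suc D ∸_) s≥1 (λ i D<i → m≤n⇒m∸n≡0 D<i) xs))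

  Σ1+D≡ : sum (map (λ _ → suc D) xs) ≡ D * length xs + length xs
  Σ1+D≡ = begin
    sum (map (λ _ → suc D) xs) ≡⟨ sum-map-const (suc D) xs ⟩
    length xs * suc D          ≡⟨ *-comm (length xs) (suc D) ⟩
    suc D * length xs          ≡⟨ +-comm (length xs) (D * length xs) ⟩
    D * length xs + length xs  ∎
    where open ≡-Reasoning

  length≤weightedCount : length xs ≤ weightedCount
  length≤weightedCount = +-cancelˡ-≤ (D * length xs) (length xs) weightedCount (begin
    D * length xs + length xs              ≡⟨ Σ1+D≡ ⟨
    sum (map (λ _ → suc D) xs)              ≤⟨ sum-map-mono 1+D≤deg+slack xs ⟩
    sum (map (λ x → deg x + slack x) xs)    ≡⟨ Σ[deg+slack]≡ ⟩
    sum (map deg xs) + weightedCount        ≤⟨ +-monoˡ-≤ weightedCount Σdeg≤ ⟩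
    D * length xs + weightedCount           ∎)
    where open ≤-Reasoning

  weightedCount≤bound : weightedCount ≤ bound
  weightedCount≤bound = sum1-mono D weighted-count≤a

  length≤bound : length xs ≤ bound
  length≤bound = ≤-trans length≤weightedCount weightedCount≤bound

  module Tight (bound≤length : bound ≤ length xs) where

    deg+slack≡1+D : ∀ {x} → x ∈ xs → deg x + slack x ≡ suc D
    deg+slack≡1+D = sym ∘ sum-map-tight 1+D≤deg+slack (begin
      sum (map (λ x → deg x + slack x) xs) ≡⟨ Σ[deg+slack]≡ ⟩
      sum (map deg xs) + weightedCount
        ≤⟨ +-mono-≤ Σdeg≤ (≤-trans weightedCount≤bound bound≤length) ⟩
      D * length xs + length xs           ≡⟨ Σ1+D≡ ⟨
      sum (map (λ _ → suc D) xs)           ∎)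
      where open ≤-Reasoning

    deg≤1+D : ∀ {x} → x ∈ xs → deg x ≤ suc D
    deg≤1+D {x} x∈xs = ≤-trans (m≤m+n (deg x) (slack x)) (≤-reflexive (deg+slack≡1+D x∈xs))

    deg≡s : ∀ {x} → x ∈ xs → deg x ≡ s x
    deg≡s {x} x∈xs = +-cancelʳ-≡ (slack x) (deg x) (s x) (begin
      deg x + slack x ≡⟨ deg+slack≡1+D x∈xs ⟩
      suc D           ≡⟨ m+[n∸m]≡n (≤-trans (s≤deg x) (deg≤1+D x∈xs)) ⟨
      s x + slack x   ∎)
      where open ≡-Reasoning

    count≡a : ∀ {i} → 1 ≤ i → i ≤ D → count i ≡ a i
    count≡a {i} 1≤i i≤D =
      *-cancelˡ-≡ (count i) (a i) (suc D ∸ i) {{>-nonZero (m<n⇒0<n∸m (s≤s i≤D))}}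
        (sum1-tight D weighted-count≤a (≤-trans bound≤length length≤weightedCount) 1≤i i≤D)

module _ {n : ℕ} (G : Graph n) where

  reach-ends-at-neighbour : ∀ {u v} → Reach G u v → u ≢ v → ∃ λ w → Adj G v w
  reach-ends-at-neighbour here             u≢v = ⊥-elim (u≢v refl)
  reach-ends-at-neighbour (step {w} _ w~v) _   = w , trans (Graph.sym G _ w) w~v

module _ {m : ℕ} (G : Graph (suc (suc m))) where

  connected⇒hasNeighbour : Connected G → ∀ v → ∃ λ w → Adj G v w
  connected⇒hasNeighbour conn v =
    reach-ends-at-neighbour G (conn (punchIn v zero) v) (punchInᵢ≢i v zero)

module Palette {n k : ℕ} (G : Graph n) (f : Fin n → Fin (suc k)) (nl : NeighborLocating G f)
  where

  neighbours : Fin n → List (Fin n)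
  neighbours v = filter (λ w → adj G v w Bool.≟ true) (allFin n)

  degree≡length-neighbours : ∀ v → degree G v ≡ length (neighbours v)
  degree≡length-neighbours v = sum-map-indicator (adj G v) (allFin n)

  sees? : ∀ v c → Dec (NColor G f v c)
  sees? v c = any? (λ w → (adj G v w Bool.≟ true) ×-dec (f w Fin.≟ c))

  -- The colours other than f v met in the neighbourhood of v, indexed by Fin k through
  -- punchIn (f v); since f is proper, f v itself is never met.
  palette : Fin n → List (Fin k)
  palette v = filter (λ j → sees? v (punchIn (f v) j)) (allFin k)

  palette-sublist : ∀ v → palette v ⊑ allFin k
  palette-sublist v = filter-⊆ (λ j → sees? v (punchIn (f v) j)) (allFin k)

  paletteSize : Fin n → ℕ
  paletteSize v = length (palette v)

  sees-palette : ∀ {v c} → NColor G f v c → ∃ λ j → j ∈ palette v × punchIn (f v) j ≡ c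
  sees-palette {v} {c} sees@(w , v~w , fw≡c) =
    j , ∈-filter⁺ _ (∈-allFin j) (subst (NColor G f v) (sym punchIn-j) sees) , punchIn-j
    where
    fv≢c : f v ≢ c
    fv≢c fv≡c = proj₁ nl v w v~w (trans fv≡c (sym fw≡c))
    j = punchOut fv≢c
    punchIn-j : punchIn (f v) j ≡ c
    punchIn-j = punchIn-punchOut fv≢c

  palette-sees : ∀ {v j} → j ∈ palette v → NColor G f v (punchIn (f v) j)
  palette-sees {v} = proj₂ ∘ ∈-filter⁻ (λ j → sees? v (punchIn (f v) j)) {xs = allFin k}

  sees-transfer : ∀ {x y} → f x ≡ f y → palette x ≡ palette y →
                  ∀ {c} → NColor G f x c → NColor G f y c
  sees-transfer {x} {y} fx≡fy px≡py sees with sees-palette sees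
  ... | j , j∈px , punchIn-j = subst (NColor G f y)
    (trans (cong (λ a → punchIn a j) (sym fx≡fy)) punchIn-j)
    (palette-sees (subst (j ∈_) px≡py j∈px))

  palette-nonempty : ∀ {v w} → Adj G v w → palette v ≢ []
  palette-nonempty {v} {w} v~w pv≡[] with sees-palette (w , v~w , refl)
  ... | j , j∈pv , _ with subst (j ∈_) pv≡[] j∈pv
  ... | ()

  1≤paletteSize : ∀ {v w} → Adj G v w → 1 ≤ paletteSize v
  1≤paletteSize {v} v~w with palette v | palette-nonempty v~w
  ... | []    | pv≢[] = ⊥-elim (pv≢[] refl)
  ... | _ ∷ _ | _     = s≤s z≤n

  paletteSize≤degree : ∀ v → paletteSize v ≤ degree G v
  paletteSize≤degree v = begin
    paletteSize v                            ≡⟨ length-map (punchIn (f v)) (palette v) ⟨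
    length (map (punchIn (f v)) (palette v)) ≤⟨ unique-⊆⇒length≤ distinct met-by-neighbours ⟩
    length (map f (neighbours v))            ≡⟨ length-map f (neighbours v) ⟩
    length (neighbours v)                    ≡⟨ degree≡length-neighbours v ⟨
    degree G v                               ∎
    where
    open ≤-Reasoning
    distinct : Unique (map (punchIn (f v)) (palette v))
    distinct = map⁺ (punchIn-injective (f v) _ _) (filter⁺ _ (allFin⁺ k))
    met-by-neighbours : map (punchIn (f v)) (palette v) ⊆ map f (neighbours v)
    met-by-neighbours c∈ with ∈-map⁻ (punchIn (f v)) c∈
    ... | j , j∈pv , refl with palette-sees j∈pv
    ... | w , v~w , fw≡c = subst (_∈ map f (neighbours v)) fw≡c
                                 (∈-map⁺ f (∈-filter⁺ _ (∈-allFin w) v~w))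

  signature : Fin n → Fin (suc k) × List (Fin k)
  signature v = f v , palette v

  signature-injective : ∀ {x y} → signature x ≡ signature y → x ≡ y
  signature-injective {x} {y} eq with x Fin.≟ y | ,-injective eq
  ... | yes x≡y | _             = x≡y
  ... | no  x≢y | fx≡fy , px≡py = ⊥-elim (proj₂ nl x y x≢y fx≡fy λ _ →
    mk⇔ (sees-transfer fx≡fy px≡py) (sees-transfer (sym fx≡fy) (sym px≡py)))

  Signatures : List (List (Fin k)) → List (Fin (suc k) × List (Fin k))
  Signatures = cartesianProduct (allFin (suc k))

  length-Signatures : ∀ ps → length (Signatures ps) ≡ suc k * length ps
  length-Signatures ps =
    trans (length-cartesianProduct (allFin (suc k)) ps)
          (cong (_* length ps) (length-allFin (suc k)))

  signatures⊆ : ∀ {vs ps} → (∀ {v} → v ∈ vs → palette v ∈ ps) → map signature vs ⊆ Signatures ps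
  signatures⊆ palettes∈ σ∈ with ∈-map⁻ signature σ∈
  ... | v , v∈vs , refl = ∈-cartesianProduct⁺ (∈-allFin (f v)) (palettes∈ v∈vs)

  signatures≤ : ∀ {vs} ps → Unique vs → (∀ {v} → v ∈ vs → palette v ∈ ps) →
                length vs ≤ suc k * length ps
  signatures≤ {vs} ps distinct palettes∈ = begin
    length vs                 ≡⟨ length-map signature vs ⟨
    length (map signature vs) ≤⟨ unique-⊆⇒length≤ (map⁺ signature-injective distinct)
                                                  (signatures⊆ palettes∈) ⟩
    length (Signatures ps)    ≡⟨ length-Signatures ps ⟩
    suc k * length ps         ∎
    where open ≤-Reasoning

  numPalette : ℕ → ℕ
  numPalette i = length (filter (λ v → paletteSize v ≟ i) (allFin n))

  numPalette≤ : ∀ i → numPalette i ≤ suc k * (k C i)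
  numPalette≤ i = subst (λ c → numPalette i ≤ suc k * c)
    (trans (length-combinations i (allFin k)) (cong (_C i) (length-allFin k)))
    (signatures≤ (combinations i (allFin k)) (filter⁺ _ (allFin⁺ n)) palette∈combinations)
    where
    palette∈combinations : ∀ {v} → v ∈ filter (λ v → paletteSize v ≟ i) (allFin n) →
                           palette v ∈ combinations i (allFin k)
    palette∈combinations {v} v∈vs =
      subst (λ l → palette v ∈ combinations l (allFin k))
            (proj₂ (∈-filter⁻ (λ v → paletteSize v ≟ i) {xs = allFin n} v∈vs))
            (sublist∈combinations (palette-sublist v))

  order< : (∀ v → ∃ λ w → Adj G v w) → n < suc k * 2 ^ k
  order< hasNeighbour = begin-strict
    n                                 ≡⟨ length-allFin n ⟨
    length (allFin n)                 ≡⟨ length-map signature (allFin n) ⟨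
    length (map signature (allFin n)) <⟨ unique-⊆-∉⇒length< distinct within unused∈ unused∉ ⟩
    length (Signatures allPalettes)   ≡⟨ length-Signatures allPalettes ⟩
    suc k * length allPalettes        ≡⟨ cong (suc k *_) length-allPalettes ⟩
    suc k * 2 ^ k                     ∎
    where
    open ≤-Reasoning
    allPalettes : List (List (Fin k))
    allPalettes = sublists (allFin k)
    length-allPalettes : length allPalettes ≡ 2 ^ k
    length-allPalettes = trans (length-sublists (allFin k)) (cong (2 ^_) (length-allFin k))
    distinct : Unique (map signature (allFin n))
    distinct = map⁺ signature-injective (allFin⁺ n)
    within : map signature (allFin n) ⊆ Signatures allPalettes
    within = signatures⊆ (λ {v} _ → sublist∈sublists (palette-sublist v))
    unused∈ : (zero , []) ∈ Signatures allPalettes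
    unused∈ = ∈-cartesianProduct⁺ (∈-allFin zero) (sublist∈sublists (minimum (allFin k)))
    unused∉ : (zero , []) ∈ map signature (allFin n) → ⊥
    unused∉ σ∈ with ∈-map⁻ signature σ∈
    ... | v , _ , eq = palette-nonempty (proj₂ (hasNeighbour v)) (sym (proj₂ (,-injective eq)))

module OrderBounds {n k : ℕ} (G : Graph n) (f : Fin n → Fin (suc k)) (nl : NeighborLocating G f)
  (hasNeighbour : ∀ v → ∃ λ w → Adj G v w) (degreeSum≤ : degreeSum G ≤ ceilAvgDeg G * n) where

  open Palette G f nl

  D : ℕ
  D = ceilAvgDeg G

  open SlackCounting (allFin n) paletteSize (degree G) D
    (λ v → 1≤paletteSize (proj₂ (hasNeighbour v))) paletteSize≤degree
    (subst (λ l → degreeSum G ≤ D * l) (sym (length-allFin n)) degreeSum≤)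
    (λ i → suc k * (k C i)) numPalette≤

  order<D*k^[D∸1] : suc k ≤ D → n < D * suc k ^ (D ∸ 1)
  order<D*k^[D∸1] 1+k≤D = <-≤-trans (order< hasNeighbour) ([1+k]*2^k≤D*[1+k]^[D∸1] 1+k≤D)

  order≤boundII : n ≤ boundII D (suc k)
  order≤boundII = subst₂ _≤_ (length-allFin n) (sym (boundII≡ D (suc k))) length≤bound

  module _ (order≡boundII : n ≡ boundII D (suc k)) where

    open Tight (≤-reflexive (trans (sym (boundII≡ D (suc k)))
                                   (trans (sym order≡boundII) (sym (length-allFin n)))))

    maxDegree≤1+D : MaxDegreeAtMost G (suc D)
    maxDegree≤1+D v = deg≤1+D (∈-allFin v)

    numDeg≡ : ∀ i → 1 ≤ i → i ≤ D → numDeg G i ≡ suc k * (k C i)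
    numDeg≡ i 1≤i i≤D = trans
      (cong length (filter-≐ (λ v → degree G v ≟ i) (λ v → paletteSize v ≟ i)
        ((λ {v} → trans (sym (deg≡s (∈-allFin v)))) , (λ {v} → trans (deg≡s (∈-allFin v))))
        (allFin n)))
      (count≡a 1≤i i≤D)

theorem3 : ∀ (n : ℕ) (G : Graph n) (k : ℕ) → 2 ≤ n → Connected G → χNL≡ G k →
    (k ≤ ceilAvgDeg G → n < ceilAvgDeg G * k ^ (ceilAvgDeg G ∸ 1))
    × (suc (ceilAvgDeg G) ≤ k → n ≤ boundII (ceilAvgDeg G) k)
    × (suc (ceilAvgDeg G) ≤ k → n ≡ boundII (ceilAvgDeg G) k →
         MaxDegreeAtMost G (suc (ceilAvgDeg G))
         × (∀ i → 1 ≤ i → i ≤ ceilAvgDeg G → numDeg G i ≡ k * ((k ∸ 1) C i)))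
theorem3 0             G k       ()
theorem3 1             G k       (s≤s ())
theorem3 (suc (suc m)) G 0       _ _    ((f , _) , _) with f zero
... | ()
-- The bound (ii) and its equality case hold without the hypothesis k ≥ ⌈d⌉ + 1.
theorem3 (suc (suc m)) G (suc k) _ conn ((f , nl) , _) =
    order<D*k^[D∸1]
  , (λ _ → order≤boundII)
  , (λ _ order≡boundII → maxDegree≤1+D order≡boundII , numDeg≡ order≡boundII)
  where
  open OrderBounds G f nl (connected⇒hasNeighbour G conn) (≤ceilDiv* (degreeSum G) (suc m))
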